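{- Let $n\geq 9$ and let $\rho_0,\ldots,\rho_{n-3}\in S_n$ be involutions whose permutation representation graph is of type (C) described in the context. Then $\langle\rho_0,\ldots,\rho_{n-3}\rangle=S_n$ and $(S_n,\{\rho_0,\ldots,\rho_{n-3}\})$ is a C-group of rank $n-2$.
   Context: A C-group of rank $r$ is a pair $(G,\{\rho_0,\ldots,\rho_{r-1}\})$ with $G$ generated by the involutions $\rho_i$ such that for all $J,K\subseteq\{0,\ldots,r-1\}$, $\langle\rho_j: j\in J\rangle\cap\langle\rho_k:k\in K\rangle=\langle\rho_j : j\in J\cap K\rangle$. The permutation representation graph has vertex set $\{1,\ldots,n\}$ and an $i$-edge $\{a,b\}$ whenever $a\rho_i=b\neq a$. Type (C): there is a tree $T$ with $n-3$ vertices in $\{1,\ldots,n\}$ whose $n-4$ edges are labelled bijectively by $2,\ldots,n-3$, $\rho_k$ ($k\geq2$) being the transposition of the endpoints of the $k$-edge; $t$ is a leaf of $T$ whose incident edge has label $2$; $a_1,a_2,a_3$ are the points not in $T$; and $\rho_0=(a_1\,a_2)(a_3\,t)$, $\rho_1=(a_1\,a_3)(a_2\,t)$ (so the $0$- and $1$-edges form an alternating square on $a_1,a_2,t,a_3$). -}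

module Defs where

open import Data.Nat using (ℕ; suc; _+_)
open import Data.Fin using (Fin; zero; suc; toℕ)
open import Data.Fin.Permutation using (Permutation′; _⟨$⟩ʳ_; id; flip; _∘ₚ_; transpose)
open import Data.Fin.Subset using (Subset; _∈_; _∩_; ⊤)
open import Data.Product using (_×_; _,_; proj₁; proj₂)
open import Data.Sum using (_⊎_)
open import Data.Empty using (⊥)
open import Relation.Nullary using (¬_)
open import Relation.Binary.PropositionalEquality using (_≡_; _≢_)

data Gen {n r : ℕ} (ρ : Fin r → Permutation′ n) (J : Subset r) : Permutation′ n → Set where
  gen-id  : Gen ρ J id
  gen-gen : ∀ {j} → j ∈ J → Gen ρ J (ρ j)
  gen-mul : ∀ {σ τ} → Gen ρ J σ → Gen ρ J τ → Gen ρ J (σ ∘ₚ τ)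
  gen-inv : ∀ {σ} → Gen ρ J σ → Gen ρ J (flip σ)
  gen-ext : ∀ {σ τ} → (∀ x → σ ⟨$⟩ʳ x ≡ τ ⟨$⟩ʳ x) → Gen ρ J σ → Gen ρ J τ

IsInvolution : {n : ℕ} → Permutation′ n → Set
IsInvolution {n} π = (∀ x → π ⟨$⟩ʳ (π ⟨$⟩ʳ x) ≡ x) × ¬ (∀ x → π ⟨$⟩ʳ x ≡ x)

IsCGroup : {n r : ℕ} → (Fin r → Permutation′ n) → Set
IsCGroup {n} {r} ρ =
  (∀ i → IsInvolution (ρ i)) ×
  (∀ (J K : Subset r) (σ : Permutation′ n) →
     ((Gen ρ J σ × Gen ρ K σ) → Gen ρ (J ∩ K) σ) ×
     (Gen ρ (J ∩ K) σ → (Gen ρ J σ × Gen ρ K σ)))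

GeneratesSym : {n r : ℕ} → (Fin r → Permutation′ n) → Set
GeneratesSym {n} {r} ρ = ∀ (σ : Permutation′ n) → Gen ρ ⊤ σ

Joins : {m p : ℕ} → (Fin m → Fin p × Fin p) → Fin m → Fin p → Fin p → Set
Joins e k x y = (e k ≡ (x , y)) ⊎ (e k ≡ (y , x))

data Reach {m p : ℕ} (e : Fin m → Fin p × Fin p) (P : Fin m → Set) : Fin p → Fin p → Set where
  here : ∀ {x} → Reach e P x x
  step : ∀ {x y z} k → P k → Joins e k x y → Reach e P y z → Reach e P x z

-- Type (C) data for n = m + 4 points (rank n - 2 = m + 2).
-- The edge with index k : Fin m carries label k + 2 (labels 2,…,n-3).

record TypeC (m : ℕ) : Set where
  field
    a₁ a₂ a₃ t : Fin (m + 4)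
    edge       : Fin m → Fin (m + 4) × Fin (m + 4)
    a₁≢a₂ : a₁ ≢ a₂
    a₁≢a₃ : a₁ ≢ a₃
    a₂≢a₃ : a₂ ≢ a₃
    a₁≢t  : a₁ ≢ t
    a₂≢t  : a₂ ≢ t
    a₃≢t  : a₃ ≢ t
    -- edges join two distinct vertices of T (vertices of T = points other than a₁,a₂,a₃)
    edge-loopless : ∀ k → proj₁ (edge k) ≢ proj₂ (edge k)
    edge-notA₁ : ∀ k x y → Joins edge k x y → x ≢ a₁
    edge-notA₂ : ∀ k x y → Joins edge k x y → x ≢ a₂
    edge-notA₃ : ∀ k x y → Joins edge k x y → x ≢ a₃
    -- T is a tree on its vertex set: connected, and every edge is a bridge (no cycles)
    connected : ∀ x y → x ≢ a₁ → x ≢ a₂ → x ≢ a₃ → y ≢ a₁ → y ≢ a₂ → y ≢ a₃ →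
                Reach edge (λ _ → Fin m) x y
    acyclic   : ∀ k → ¬ Reach edge (λ l → l ≢ k) (proj₁ (edge k)) (proj₂ (edge k))
    -- t is a leaf of T whose incident edge has label 2
    edge₂      : Fin m
    edge₂-label : toℕ edge₂ ≡ 0
    t-on-2     : (t ≡ proj₁ (edge edge₂)) ⊎ (t ≡ proj₂ (edge edge₂))
    t-leaf     : ∀ k x → Joins edge k t x → k ≡ edge₂

ρ : {m : ℕ} → TypeC m → Fin (2 + m) → Permutation′ (m + 4)
ρ T zero = transpose a₁ a₂ ∘ₚ transpose a₃ t
  where open TypeC T
ρ T (suc zero) = transpose a₁ a₃ ∘ₚ transpose a₂ t
  where open TypeC T
ρ T (suc (suc k)) = transpose (proj₁ (edge k)) (proj₂ (edge k))
  where open TypeC T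

module Submission where

-- Write each point x by two coordinates: its tree point (the square
-- a₁,a₂,a₃,t collapsed onto t) and its square coordinate in 𝔽₂², where
-- a₁,a₂,a₃,t are 00,10,01,11 and ρ₀, ρ₁ act as the translations by 10, 01.
-- For J ⊆ {0,…,n-3}, the orbits of ⟨ρ_j : j ∈ J⟩ are then described by
-- the forest of J-edges of T and by the translations available in J; since
-- T is a tree (unique paths) the (J ∩ K)-orbits are the intersections of
-- the J- and K-orbits.  Next ⟨ρ_j : j ∈ J⟩ is characterised from its
-- orbits: if 2 ∈ J every generator step is a generated transposition, so
-- the subgroup is the Young subgroup of its orbits; if 2 ∉ J the square is
-- cut off from T, the subgroup acts on it by translations, and undoing the
-- translation leaves a permutation inside the Young subgroup of the forest.
-- Both the intersection property and ⟨ρ_0,…,ρ_{n-3}⟩ = S_n follow.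

open import Defs
open import Data.Bool using (Bool; true; false; _xor_)
open import Data.Bool.Properties using (xor-assoc; xor-same; xor-identityʳ)
open import Data.Empty using (⊥-elim)
open import Data.Fin using (Fin; zero; suc)
open import Data.Fin.Properties using (_≟_)
open import Data.Fin.Permutation using (Permutation′; _⟨$⟩ʳ_; _⟨$⟩ˡ_; id; flip; _∘ₚ_; transpose; inverseˡ; inverseʳ)
import Data.Fin.Permutation.Components as Components
open import Data.Fin.Subset using (Subset; _∈_; _∉_; _∩_; _⊆_; ⊤)
open import Data.Fin.Subset.Properties using (_∈?_; ∈⊤; x∈p∩q⁺; p∩q⊆p; p∩q⊆q)
open import Data.List using ([]; _∷_; allFin)
open import Data.List.Membership.Propositional using () renaming (_∈_ to _∈ₗ_; _∉_ to _∉ₗ_)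
open import Data.List.Membership.Propositional.Properties using (∈-allFin)
import Data.List.Relation.Unary.Any as Any
open import Data.Nat using (ℕ; _+_; _≤_)
open import Data.Product using (Σ; _×_; _,_; proj₁; proj₂)
open import Data.Sum using (_⊎_; inj₁; inj₂)
open import Data.Unit using (tt) renaming (⊤ to Unit)
open import Relation.Nullary using (¬_; Dec; yes; no)
open import Relation.Nullary.Decidable using (dec-true; dec-false)
open import Relation.Binary.PropositionalEquality
  using (_≡_; _≢_; ≢-sym; refl; sym; trans; cong; cong₂; subst; subst₂; module ≡-Reasoning)

-- Pointwise facts about transpositions.  Permutations act on the right:
-- (σ ∘ₚ τ) ⟨$⟩ʳ x = τ ⟨$⟩ʳ (σ ⟨$⟩ʳ x).
module _ {n : ℕ} where

  ⟨$⟩ʳ-injective : (π : Permutation′ n) {x y : Fin n} → π ⟨$⟩ʳ x ≡ π ⟨$⟩ʳ y → x ≡ y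
  ⟨$⟩ʳ-injective π {x} {y} eq =
    trans (sym (inverseˡ π)) (trans (cong (π ⟨$⟩ˡ_) eq) (inverseˡ π))

  transpose-matchˡ : (i j : Fin n) → transpose i j ⟨$⟩ʳ i ≡ j
  transpose-matchˡ i j rewrite dec-true (i ≟ i) refl = refl

  transpose-matchʳ : (i j : Fin n) → transpose i j ⟨$⟩ʳ j ≡ i
  transpose-matchʳ i j with j ≟ i
  ... | yes j≡i = j≡i
  ... | no _ rewrite dec-true (j ≟ j) refl = refl

  transpose-other : (i j k : Fin n) → k ≢ i → k ≢ j → transpose i j ⟨$⟩ʳ k ≡ k
  transpose-other i j k k≢i k≢j rewrite dec-false (k ≟ i) k≢i | dec-false (k ≟ j) k≢j = refl

  data TransposeCase (i j k : Fin n) : Set where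
    at-i      : k ≡ i → TransposeCase i j k
    at-j      : k ≢ i → k ≡ j → TransposeCase i j k
    elsewhere : k ≢ i → k ≢ j → TransposeCase i j k

  transposeCase : (i j k : Fin n) → TransposeCase i j k
  transposeCase i j k with k ≟ i | k ≟ j
  ... | yes k≡i | _       = at-i k≡i
  ... | no k≢i  | yes k≡j = at-j k≢i k≡j
  ... | no k≢i  | no k≢j  = elsewhere k≢i k≢j

  transpose-comm : (i j k : Fin n) → transpose i j ⟨$⟩ʳ k ≡ transpose j i ⟨$⟩ʳ k
  transpose-comm i j k with transposeCase i j k
  ... | at-i refl     = trans (transpose-matchˡ k j) (sym (transpose-matchʳ j k))
  ... | at-j _ refl   = trans (transpose-matchʳ i k) (sym (transpose-matchˡ k i))
  ... | elsewhere k≢i k≢j =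
    trans (transpose-other i j k k≢i k≢j) (sym (transpose-other j i k k≢j k≢i))

  transpose-diag : (i k : Fin n) → transpose i i ⟨$⟩ʳ k ≡ k
  transpose-diag i k with transposeCase i i k
  ... | at-i refl         = transpose-matchˡ k k
  ... | at-j k≢i k≡i      = ⊥-elim (k≢i k≡i)
  ... | elsewhere k≢i _   = transpose-other i i k k≢i k≢i

  transpose-involutive : (i j k : Fin n) → transpose i j ⟨$⟩ʳ (transpose i j ⟨$⟩ʳ k) ≡ k
  transpose-involutive i j k =
    trans (transpose-comm i j (transpose i j ⟨$⟩ʳ k)) (Components.transpose-inverse j i)

  transpose-conjugate : (π : Permutation′ n) (a b y : Fin n) →
    π ⟨$⟩ʳ (transpose a b ⟨$⟩ʳ y) ≡ transpose (π ⟨$⟩ʳ a) (π ⟨$⟩ʳ b) ⟨$⟩ʳ (π ⟨$⟩ʳ y)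
  transpose-conjugate π a b y with transposeCase a b y
  ... | at-i refl =
    trans (cong (π ⟨$⟩ʳ_) (transpose-matchˡ y b)) (sym (transpose-matchˡ (π ⟨$⟩ʳ y) (π ⟨$⟩ʳ b)))
  ... | at-j _ refl =
    trans (cong (π ⟨$⟩ʳ_) (transpose-matchʳ a y)) (sym (transpose-matchʳ (π ⟨$⟩ʳ a) (π ⟨$⟩ʳ y)))
  ... | elsewhere y≢a y≢b =
    trans (cong (π ⟨$⟩ʳ_) (transpose-other a b y y≢a y≢b))
          (sym (transpose-other (π ⟨$⟩ʳ a) (π ⟨$⟩ʳ b) (π ⟨$⟩ʳ y)
                  (λ e → y≢a (⟨$⟩ʳ-injective π e)) (λ e → y≢b (⟨$⟩ʳ-injective π e))))

power : {n : ℕ} → Bool → Permutation′ n → Permutation′ n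
power false π = id
power true  π = π

-- The factor (g i)^b lies in ⟨g j : j ∈ J⟩ by construction: b = 0 or i ∈ J.
Uses : {r : ℕ} → Bool → Fin r → Subset r → Set
Uses false i J = Unit
Uses true  i J = i ∈ J

module Generation {n r : ℕ} (g : Fin r → Permutation′ n) (J : Subset r) where

  power-gen : ∀ b i → Uses b i J → Gen g J (power b (g i))
  power-gen false i _   = gen-id
  power-gen true  i i∈J = gen-gen i∈J

  transposition-self : ∀ x → Gen g J (transpose x x)
  transposition-self x = gen-ext (λ y → sym (transpose-diag x y)) gen-id

  transposition-flip : ∀ {x y} → Gen g J (transpose x y) → Gen g J (transpose y x)
  transposition-flip {x} {y} = gen-ext (transpose-comm x y)

  transposition-conjugate : ∀ {π a b} → Gen g J π → Gen g J (transpose a b) →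
                            Gen g J (transpose (π ⟨$⟩ʳ a) (π ⟨$⟩ʳ b))
  transposition-conjugate {π} {a} {b} gπ gab = gen-ext pointwise (gen-mul (gen-inv gπ) (gen-mul gab gπ))
    where
    pointwise : ∀ x → π ⟨$⟩ʳ (transpose a b ⟨$⟩ʳ (π ⟨$⟩ˡ x)) ≡ transpose (π ⟨$⟩ʳ a) (π ⟨$⟩ʳ b) ⟨$⟩ʳ x
    pointwise x = trans (transpose-conjugate π a b (π ⟨$⟩ˡ x))
                        (cong (transpose (π ⟨$⟩ʳ a) (π ⟨$⟩ʳ b) ⟨$⟩ʳ_) (inverseʳ π))

  -- (x z) = (x y)(y z)(x y), so transpositions along a chain compose.
  transposition-chain : ∀ {x y z} → Gen g J (transpose x y) → Gen g J (transpose y z) →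
                        Gen g J (transpose x z)
  transposition-chain {x} {y} {z} gxy gyz with transposeCase x y z
  ... | at-i refl         = transposition-self z
  ... | at-j _ refl       = gxy
  ... | elsewhere z≢x z≢y =
    subst₂ (λ a b → Gen g J (transpose a b)) (transpose-matchʳ x y) (transpose-other x y z z≢x z≢y)
           (transposition-conjugate gxy gyz)

  transposition-split : ∀ {a b c d} → Gen g J (transpose a b ∘ₚ transpose c d) →
                        Gen g J (transpose c d) → Gen g J (transpose a b)
  transposition-split {a} {b} {c} {d} gabcd gcd =
    gen-ext (λ x → transpose-involutive c d (transpose a b ⟨$⟩ʳ x)) (gen-mul gabcd gcd)

  module Young (R : Fin n → Fin n → Set)
               (R-sym : ∀ {x y} → R x y → R y x)
               (R-trans : ∀ {x y z} → R x y → R y z → R x z)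
               (R-gen : ∀ {x y} → R x y → Gen g J (transpose x y)) where

    module Correct (σ : Permutation′ n) (x : Fin n) where
      σ′ : Permutation′ n
      σ′ = σ ∘ₚ transpose x (σ ⟨$⟩ʳ x)

      fixes-x : σ′ ⟨$⟩ʳ x ≡ x
      fixes-x = transpose-matchʳ x (σ ⟨$⟩ʳ x)

      keeps-fixed : ∀ y → σ ⟨$⟩ʳ y ≡ y → σ′ ⟨$⟩ʳ y ≡ y
      keeps-fixed y σy≡y with y ≟ x
      ... | yes refl = fixes-x
      ... | no y≢x   = trans (cong (transpose x (σ ⟨$⟩ʳ x) ⟨$⟩ʳ_) σy≡y)
                             (transpose-other x (σ ⟨$⟩ʳ x) y y≢x
                               (λ y≡σx → y≢x (⟨$⟩ʳ-injective σ (trans σy≡y y≡σx))))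

      stays-related : (∀ y → R y (σ ⟨$⟩ʳ y)) → ∀ y → R y (σ′ ⟨$⟩ʳ y)
      stays-related rel y with transposeCase x (σ ⟨$⟩ʳ x) (σ ⟨$⟩ʳ y)
      ... | at-i σy≡x rewrite σy≡x | transpose-matchˡ x (σ ⟨$⟩ʳ x) =
        R-trans (subst (R y) σy≡x (rel y)) (rel x)
      ... | at-j _ σy≡σx rewrite σy≡σx | transpose-matchʳ x (σ ⟨$⟩ʳ x) =
        R-trans (subst (R y) σy≡σx (rel y)) (R-sym (rel x))
      ... | elsewhere ne₁ ne₂ rewrite transpose-other x (σ ⟨$⟩ʳ x) (σ ⟨$⟩ʳ y) ne₁ ne₂ = rel y

      recovers : ∀ y → (σ′ ∘ₚ transpose x (σ ⟨$⟩ʳ x)) ⟨$⟩ʳ y ≡ σ ⟨$⟩ʳ y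
      recovers y = transpose-involutive x (σ ⟨$⟩ʳ x) (σ ⟨$⟩ʳ y)

    young-support : ∀ xs σ → (∀ y → R y (σ ⟨$⟩ʳ y)) → (∀ y → y ∉ₗ xs → σ ⟨$⟩ʳ y ≡ y) → Gen g J σ
    young-support []       σ rel fixed = gen-ext (λ y → sym (fixed y λ ())) gen-id
    young-support (x ∷ xs) σ rel fixed =
      gen-ext recovers (gen-mul (young-support xs σ′ (stays-related rel) fixed′) (R-gen (rel x)))
      where
      open Correct σ x
      fixed′ : ∀ y → y ∉ₗ xs → σ′ ⟨$⟩ʳ y ≡ y
      fixed′ y y∉xs with y ≟ x
      ... | yes refl = fixes-x
      ... | no y≢x   = keeps-fixed y (fixed y λ { (Any.here y≡x) → y≢x y≡x ; (Any.there y∈xs) → y∉xs y∈xs })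

    young : ∀ σ → (∀ y → R y (σ ⟨$⟩ʳ y)) → Gen g J σ
    young σ rel = young-support (allFin n) σ rel (λ y y∉ → ⊥-elim (y∉ (∈-allFin y)))

gen-mono : ∀ {n r} {g : Fin r → Permutation′ n} {J K : Subset r} {σ} →
           J ⊆ K → Gen g J σ → Gen g K σ
gen-mono J⊆K gen-id          = gen-id
gen-mono J⊆K (gen-gen j∈J)   = gen-gen (J⊆K j∈J)
gen-mono J⊆K (gen-mul gσ gτ) = gen-mul (gen-mono J⊆K gσ) (gen-mono J⊆K gτ)
gen-mono J⊆K (gen-inv gσ)    = gen-inv (gen-mono J⊆K gσ)
gen-mono J⊆K (gen-ext eq gσ) = gen-ext eq (gen-mono J⊆K gσ)

module Orbits {n r : ℕ} (g : Fin r → Permutation′ n)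
              (involutive : ∀ i x → g i ⟨$⟩ʳ (g i ⟨$⟩ʳ x) ≡ x) where

  data Orbit (J : Subset r) : Fin n → Fin n → Set where
    stay : ∀ {x} → Orbit J x x
    move : ∀ {x z} i → i ∈ J → Orbit J (g i ⟨$⟩ʳ x) z → Orbit J x z

  orbit-trans : ∀ {J x y z} → Orbit J x y → Orbit J y z → Orbit J x z
  orbit-trans stay             oyz = oyz
  orbit-trans (move i i∈J oxy) oyz = move i i∈J (orbit-trans oxy oyz)

  orbit-sym : ∀ {J x y} → Orbit J x y → Orbit J y x
  orbit-sym stay                 = stay
  orbit-sym {J} {x} (move i i∈J o) =
    orbit-trans (orbit-sym o) (move i i∈J (subst (λ w → Orbit J w x) (sym (involutive i x)) stay))

  orbit-of-gen : ∀ {J σ} → Gen g J σ → ∀ x → Orbit J x (σ ⟨$⟩ʳ x)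
  orbit-of-gen gen-id                 x = stay
  orbit-of-gen (gen-gen {j} j∈J)      x = move j j∈J stay
  orbit-of-gen (gen-mul {σ} gσ gτ)    x = orbit-trans (orbit-of-gen gσ x) (orbit-of-gen gτ (σ ⟨$⟩ʳ x))
  orbit-of-gen {J} (gen-inv {σ} gσ)   x =
    orbit-sym (subst (Orbit J (σ ⟨$⟩ˡ x)) (inverseʳ σ) (orbit-of-gen gσ (σ ⟨$⟩ˡ x)))
  orbit-of-gen {J} (gen-ext eq gσ)    x = subst (Orbit J x) (eq x) (orbit-of-gen gσ x)

  module _ {J : Subset r}
           (steps : ∀ i → i ∈ J → ∀ x → Gen g J (transpose x (g i ⟨$⟩ʳ x))) where
    open Generation g J

    orbit-transposition : ∀ {x y} → Orbit J x y → Gen g J (transpose x y)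
    orbit-transposition {x} stay           = transposition-self x
    orbit-transposition {x} (move i i∈J o) = transposition-chain (steps i i∈J x) (orbit-transposition o)

    orbit-young : ∀ σ → (∀ x → Orbit J x (σ ⟨$⟩ʳ x)) → Gen g J σ
    orbit-young = Young.young (Orbit J) orbit-sym orbit-trans orbit-transposition

module Paths {m p : ℕ} (e : Fin m → Fin p × Fin p) where

  joins-sym : ∀ {k x y} → Joins e k x y → Joins e k y x
  joins-sym (inj₁ eq) = inj₂ eq
  joins-sym (inj₂ eq) = inj₁ eq

  joins-endpoint : ∀ {k x y} → Joins e k x y → (x ≡ proj₁ (e k)) ⊎ (x ≡ proj₂ (e k))
  joins-endpoint (inj₁ eq) = inj₁ (sym (cong proj₁ eq))
  joins-endpoint (inj₂ eq) = inj₂ (sym (cong proj₂ eq))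

  reach-mono : ∀ {P Q : Fin m → Set} → (∀ {k} → P k → Q k) → ∀ {x y} → Reach e P x y → Reach e Q x y
  reach-mono P⇒Q here              = here
  reach-mono P⇒Q (step k pk j r)   = step k (P⇒Q pk) j (reach-mono P⇒Q r)

  reach-trans : ∀ {P x y z} → Reach e P x y → Reach e P y z → Reach e P x z
  reach-trans here            r′ = r′
  reach-trans (step k pk j r) r′ = step k pk j (reach-trans r r′)

  reach-sym : ∀ {P x y} → Reach e P x y → Reach e P y x
  reach-sym here            = here
  reach-sym (step k pk j r) = reach-trans (reach-sym r) (step k pk (joins-sym j) here)

  Avoiding : (Fin m → Set) → Fin m → Fin m → Set
  Avoiding P k l = P l × l ≢ k

  first-use : ∀ {P} k {x y} → Reach e P x y →
              Reach e (Avoiding P k) x y ⊎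
              Σ (Fin p) (λ u → Σ (Fin p) (λ v → Reach e (Avoiding P k) x u × Joins e k u v))
  first-use k here = inj₁ here
  first-use k (step l pl j r) with l ≟ k
  ... | yes refl = inj₂ (_ , _ , here , j)
  ... | no l≢k with first-use k r
  ...   | inj₁ r′               = inj₁ (step l (pl , l≢k) j r′)
  ...   | inj₂ (u , v , r′ , j′) = inj₂ (u , v , step l (pl , l≢k) j r′ , j′)

  module _ (acyclic : ∀ k → ¬ Reach e (λ l → l ≢ k) (proj₁ (e k)) (proj₂ (e k))) where

    -- If x and y are joined avoiding k, then any P-path between them can be
    -- shortened to avoid k: otherwise its first and last use of k would
    -- close a cycle through k.
    avoid : ∀ {P} k {x y} → Reach e P x y → Reach e (λ l → l ≢ k) x y → Reach e (Avoiding P k) x y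
    avoid {P} k {x} {y} r q with first-use k r | first-use k (reach-sym r)
    ... | inj₁ r′ | _        = r′
    ... | inj₂ _  | inj₁ r″  = reach-sym r″
    ... | inj₂ (u , _ , xu , ju) | inj₂ (z , _ , yz , jz) = close (joins-endpoint ju) (joins-endpoint jz)
      where
      forget : ∀ {a b} → Reach e (Avoiding P k) a b → Reach e (λ l → l ≢ k) a b
      forget = reach-mono proj₂
      u⇝z : Reach e (λ l → l ≢ k) u z
      u⇝z = reach-trans (reach-sym (forget xu)) (reach-trans q (forget yz))
      glue : u ≡ z → Reach e (Avoiding P k) x y
      glue u≡z = reach-trans xu (subst (λ w → Reach e (Avoiding P k) w y) (sym u≡z) (reach-sym yz))
      close : (u ≡ proj₁ (e k)) ⊎ (u ≡ proj₂ (e k)) → (z ≡ proj₁ (e k)) ⊎ (z ≡ proj₂ (e k)) →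
              Reach e (Avoiding P k) x y
      close (inj₁ u≡) (inj₁ z≡) = glue (trans u≡ (sym z≡))
      close (inj₂ u≡) (inj₂ z≡) = glue (trans u≡ (sym z≡))
      close (inj₁ u≡) (inj₂ z≡) = ⊥-elim (acyclic k (subst₂ (Reach e (λ l → l ≢ k)) u≡ z≡ u⇝z))
      close (inj₂ u≡) (inj₁ z≡) = ⊥-elim (acyclic k (subst₂ (Reach e (λ l → l ≢ k)) z≡ u≡ (reach-sym u⇝z)))

    reach-meet : ∀ {P Q : Fin m → Set} → (∀ k → Dec (Q k)) → ∀ {x y} →
                 Reach e P x y → Reach e Q x y → Reach e (λ l → P l × Q l) x y
    reach-meet {P} {Q} Q? {x} {y} rp rq =
      reach-mono (λ {l} (pl , q-on) → pl , q-on (∈-allFin l)) (restrict (allFin m))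
      where
      restrict : ∀ xs → Reach e (λ l → P l × (l ∈ₗ xs → Q l)) x y
      restrict []       = reach-mono (λ pl → pl , λ ()) rp
      restrict (k ∷ xs) with Q? k
      ... | yes qk = reach-mono (λ {l} (pl , q-on) → pl , λ { (Any.here refl) → qk ; (Any.there l∈) → q-on l∈ })
                                (restrict xs)
      ... | no ¬qk = reach-mono (λ {l} ((pl , q-on) , l≢k) → pl , λ { (Any.here l≡k) → ⊥-elim (l≢k l≡k)
                                                                      ; (Any.there l∈) → q-on l∈ })
                                (avoid k (restrict xs) (reach-mono (λ {l} ql l≡k → ¬qk (subst Q l≡k ql)) rq))

-- The alternating square as the Klein four-group 𝔽₂²: coordinate-wise
-- xor is the translation action, and ρ₀, ρ₁ translate by e₀, e₁.
module KleinSquare where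

  Sq : Set
  Sq = Bool × Bool

  o e₀ e₁ top : Sq
  o   = false , false
  e₀  = true  , false
  e₁  = false , true
  top = true  , true

  infixl 6 _⊕_
  _⊕_ : Sq → Sq → Sq
  (a , b) ⊕ (c , d) = (a xor c) , (b xor d)

  ⊕-assoc : ∀ s h k → s ⊕ h ⊕ k ≡ s ⊕ (h ⊕ k)
  ⊕-assoc (a , b) (c , d) (e , f) = cong₂ _,_ (xor-assoc a c e) (xor-assoc b d f)

  ⊕-self : ∀ s → s ⊕ s ≡ o
  ⊕-self (a , b) = cong₂ _,_ (xor-same a) (xor-same b)

  ⊕-identityʳ : ∀ s → s ⊕ o ≡ s
  ⊕-identityʳ (a , b) = cong₂ _,_ (xor-identityʳ a) (xor-identityʳ b)

  ⊕-cancelʳ : ∀ s h → s ⊕ h ⊕ h ≡ s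
  ⊕-cancelʳ s h = begin
    s ⊕ h ⊕ h   ≡⟨ ⊕-assoc s h h ⟩
    s ⊕ (h ⊕ h) ≡⟨ cong (s ⊕_) (⊕-self h) ⟩
    s ⊕ o       ≡⟨ ⊕-identityʳ s ⟩
    s           ∎
    where open ≡-Reasoning

  ⊕-cancelˡ : ∀ s h → s ⊕ (s ⊕ h) ≡ h
  ⊕-cancelˡ s h = trans (sym (⊕-assoc s s h)) (cong (_⊕ h) (⊕-self s))

  ⊕-middle : ∀ s s′ s″ → (s ⊕ s′) ⊕ (s′ ⊕ s″) ≡ s ⊕ s″
  ⊕-middle s s′ s″ = trans (⊕-assoc s s′ (s′ ⊕ s″)) (cong (s ⊕_) (⊕-cancelˡ s′ s″))

  -- Translations realisable inside ⟨ρ_j : j ∈ J⟩: the coordinate of eᵢ may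
  -- be 1 only when i ∈ J.
  Allowed : ∀ {r} → Subset (2 + r) → Sq → Set
  Allowed J (b₀ , b₁) = Uses b₀ zero J × Uses b₁ (suc zero) J

  Allowed-⊕ : ∀ {r} {J : Subset (2 + r)} h k → Allowed J h → Allowed J k → Allowed J (h ⊕ k)
  Allowed-⊕ {J = J} (a , b) (c , d) (ua , ub) (uc , ud) = uses-xor a c ua uc , uses-xor b d ub ud
    where
    uses-xor : ∀ {i} a c → Uses a i J → Uses c i J → Uses (a xor c) i J
    uses-xor false c     _  uc = uc
    uses-xor true  false ua _  = ua
    uses-xor true  true  _  _  = tt

  Allowed-∩ : ∀ {r} {J K : Subset (2 + r)} h → Allowed J h → Allowed K h → Allowed (J ∩ K) h
  Allowed-∩ {J = J} {K} (a , b) (ua , ub) (va , vb) = uses-∩ a ua va , uses-∩ b ub vb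
    where
    uses-∩ : ∀ {i} a → Uses a i J → Uses a i K → Uses a i (J ∩ K)
    uses-∩ false _   _   = tt
    uses-∩ true  i∈J i∈K = x∈p∩q⁺ (i∈J , i∈K)

  Allowed-⊤ : ∀ {r} h → Allowed {r} ⊤ h
  Allowed-⊤ (a , b) = uses-⊤ a , uses-⊤ b
    where
    uses-⊤ : ∀ {r} {i : Fin r} a → Uses a i ⊤
    uses-⊤ false = tt
    uses-⊤ true  = ∈⊤

  SquareOrbit : ∀ {r} → Subset (2 + r) → Sq → Sq → Set
  SquareOrbit J s s′ = Allowed J (s ⊕ s′)

  square-orbit-refl : ∀ {r} {J : Subset (2 + r)} s → SquareOrbit J s s
  square-orbit-refl {J = J} s = subst (Allowed J) (sym (⊕-self s)) (tt , tt)

  square-orbit-trans : ∀ {r} {J : Subset (2 + r)} s s′ s″ →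
                       SquareOrbit J s s′ → SquareOrbit J s′ s″ → SquareOrbit J s s″
  square-orbit-trans {J = J} s s′ s″ o₁ o₂ =
    subst (Allowed J) (⊕-middle s s′ s″) (Allowed-⊕ (s ⊕ s′) (s′ ⊕ s″) o₁ o₂)

open KleinSquare

module TypeCGroup {m : ℕ} (T : TypeC m) where
  open TypeC T
  open Paths edge

  Point : Set
  Point = Fin (m + 4)

  corner : Sq → Point
  corner (false , false) = a₁
  corner (true  , false) = a₂
  corner (false , true)  = a₃
  corner (true  , true)  = t

  corner-injective : ∀ s s′ → corner s ≡ corner s′ → s ≡ s′
  corner-injective (false , false) (false , false) _ = refl
  corner-injective (false , false) (true  , false) e = ⊥-elim (a₁≢a₂ e)
  corner-injective (false , false) (false , true)  e = ⊥-elim (a₁≢a₃ e)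
  corner-injective (false , false) (true  , true)  e = ⊥-elim (a₁≢t e)
  corner-injective (true  , false) (false , false) e = ⊥-elim (a₁≢a₂ (sym e))
  corner-injective (true  , false) (true  , false) _ = refl
  corner-injective (true  , false) (false , true)  e = ⊥-elim (a₂≢a₃ e)
  corner-injective (true  , false) (true  , true)  e = ⊥-elim (a₂≢t e)
  corner-injective (false , true)  (false , false) e = ⊥-elim (a₁≢a₃ (sym e))
  corner-injective (false , true)  (true  , false) e = ⊥-elim (a₂≢a₃ (sym e))
  corner-injective (false , true)  (false , true)  _ = refl
  corner-injective (false , true)  (true  , true)  e = ⊥-elim (a₃≢t e)
  corner-injective (true  , true)  (false , false) e = ⊥-elim (a₁≢t (sym e))
  corner-injective (true  , true)  (true  , false) e = ⊥-elim (a₂≢t (sym e))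
  corner-injective (true  , true)  (false , true)  e = ⊥-elim (a₃≢t (sym e))
  corner-injective (true  , true)  (true  , true)  _ = refl

  OffSquare : Point → Set
  OffSquare x = ∀ s → x ≢ corner s

  off-square : ∀ {x} → x ≢ a₁ → x ≢ a₂ → x ≢ a₃ → x ≢ t → OffSquare x
  off-square x≢a₁ _ _ _ (false , false) = x≢a₁
  off-square _ x≢a₂ _ _ (true  , false) = x≢a₂
  off-square _ _ x≢a₃ _ (false , true)  = x≢a₃
  off-square _ _ _ x≢t  (true  , true)  = x≢t

  data SquareView (x : Point) : Set where
    onSquare  : ∀ s → x ≡ corner s → SquareView x
    offSquare : OffSquare x → SquareView x

  squareView : ∀ x → SquareView x
  squareView x with x ≟ a₁ | x ≟ a₂ | x ≟ a₃ | x ≟ t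
  ... | yes x≡ | _     | _     | _     = onSquare o x≡
  ... | no _   | yes x≡ | _    | _     = onSquare e₀ x≡
  ... | no _   | no _  | yes x≡ | _    = onSquare e₁ x≡
  ... | no _   | no _  | no _  | yes x≡ = onSquare top x≡
  ... | no n₁  | no n₂ | no n₃ | no n₄ = offSquare (off-square n₁ n₂ n₃ n₄)

  sqCoord : Point → Sq
  sqCoord x with squareView x
  ... | onSquare s _  = s
  ... | offSquare _   = top

  treePoint : Point → Point
  treePoint x with squareView x
  ... | onSquare _ _  = t
  ... | offSquare _   = x

  sqCoord-corner : ∀ s → sqCoord (corner s) ≡ s
  sqCoord-corner s with squareView (corner s)
  ... | onSquare s′ eq = sym (corner-injective s s′ eq)
  ... | offSquare off  = ⊥-elim (off s refl)

  treePoint-corner : ∀ s → treePoint (corner s) ≡ t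
  treePoint-corner s with squareView (corner s)
  ... | onSquare _ _  = refl
  ... | offSquare off = ⊥-elim (off s refl)

  sqCoord-off : ∀ {x} → OffSquare x → sqCoord x ≡ top
  sqCoord-off {x} off with squareView x
  ... | onSquare s eq = ⊥-elim (off s eq)
  ... | offSquare _   = refl

  treePoint-off : ∀ {x} → OffSquare x → treePoint x ≡ x
  treePoint-off {x} off with squareView x
  ... | onSquare s eq = ⊥-elim (off s eq)
  ... | offSquare _   = refl

  endpoint-coordinates : ∀ {k x y} → Joins edge k x y → sqCoord x ≡ top × treePoint x ≡ x
  endpoint-coordinates {k} {x} {y} j with squareView x
  ... | onSquare (false , false) refl = ⊥-elim (edge-notA₁ k x y j refl)
  ... | onSquare (true  , false) refl = ⊥-elim (edge-notA₂ k x y j refl)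
  ... | onSquare (false , true)  refl = ⊥-elim (edge-notA₃ k x y j refl)
  ... | onSquare (true  , true)  refl = refl , refl
  ... | offSquare _                   = refl , refl

  joins-distinct : ∀ {k x y} → Joins edge k x y → x ≢ y
  joins-distinct {k} (inj₁ eq) x≡y = edge-loopless k (trans (cong proj₁ eq) (trans x≡y (sym (cong proj₂ eq))))
  joins-distinct {k} (inj₂ eq) x≡y = edge-loopless k (trans (cong proj₁ eq) (trans (sym x≡y) (sym (cong proj₂ eq))))

  edge-step : ∀ k x → Joins edge k x (ρ T (suc (suc k)) ⟨$⟩ʳ x) ⊎ (ρ T (suc (suc k)) ⟨$⟩ʳ x ≡ x)
  edge-step k x with transposeCase (proj₁ (edge k)) (proj₂ (edge k)) x
  ... | at-i refl         = inj₁ (inj₁ (cong (x ,_) (sym (transpose-matchˡ x (proj₂ (edge k))))))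
  ... | at-j _ refl       = inj₁ (inj₂ (cong (_, x) (sym (transpose-matchʳ (proj₁ (edge k)) x))))
  ... | elsewhere ne₁ ne₂ = inj₂ (transpose-other (proj₁ (edge k)) (proj₂ (edge k)) x ne₁ ne₂)

  joins-moves : ∀ {k x y} → Joins edge k x y → ρ T (suc (suc k)) ⟨$⟩ʳ x ≡ y
  joins-moves {k} {x} {y} (inj₁ eq) rewrite eq = transpose-matchˡ x y
  joins-moves {k} {x} {y} (inj₂ eq) rewrite eq = transpose-matchʳ y x

  data SquareGenerator : Fin (2 + m) → Sq → Set where
    is-ρ₀ : SquareGenerator zero e₀
    is-ρ₁ : SquareGenerator (suc zero) e₁

  square-generator-form : ∀ {i e} → SquareGenerator i e →
    ρ T i ≡ transpose (corner o) (corner (o ⊕ e)) ∘ₚ transpose (corner (top ⊕ e)) t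
  square-generator-form is-ρ₀ = refl
  square-generator-form is-ρ₁ = refl

  square-generator-corner : ∀ {i e} → SquareGenerator i e → ∀ s → ρ T i ⟨$⟩ʳ corner s ≡ corner (s ⊕ e)
  square-generator-corner is-ρ₀ (false , false) rewrite transpose-matchˡ a₁ a₂ =
    transpose-other a₃ t a₂ a₂≢a₃ a₂≢t
  square-generator-corner is-ρ₀ (true  , false) rewrite transpose-matchʳ a₁ a₂ =
    transpose-other a₃ t a₁ a₁≢a₃ a₁≢t
  square-generator-corner is-ρ₀ (false , true)
    rewrite transpose-other a₁ a₂ a₃ (≢-sym a₁≢a₃) (≢-sym a₂≢a₃) = transpose-matchˡ a₃ t
  square-generator-corner is-ρ₀ (true  , true)
    rewrite transpose-other a₁ a₂ t (≢-sym a₁≢t) (≢-sym a₂≢t) = transpose-matchʳ a₃ t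
  square-generator-corner is-ρ₁ (false , false) rewrite transpose-matchˡ a₁ a₃ =
    transpose-other a₂ t a₃ (≢-sym a₂≢a₃) a₃≢t
  square-generator-corner is-ρ₁ (true  , false)
    rewrite transpose-other a₁ a₃ a₂ (≢-sym a₁≢a₂) a₂≢a₃ = transpose-matchˡ a₂ t
  square-generator-corner is-ρ₁ (false , true) rewrite transpose-matchʳ a₁ a₃ =
    transpose-other a₂ t a₁ a₁≢a₂ a₁≢t
  square-generator-corner is-ρ₁ (true  , true)
    rewrite transpose-other a₁ a₃ t (≢-sym a₁≢t) (≢-sym a₃≢t) = transpose-matchʳ a₂ t

  square-generator-off : ∀ {i e x} → SquareGenerator i e → OffSquare x → ρ T i ⟨$⟩ʳ x ≡ x
  square-generator-off {x = x} is-ρ₀ off rewrite transpose-other a₁ a₂ x (off o) (off e₀) =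
    transpose-other a₃ t x (off e₁) (off top)
  square-generator-off {x = x} is-ρ₁ off rewrite transpose-other a₁ a₃ x (off o) (off e₁) =
    transpose-other a₂ t x (off e₀) (off top)

  square-generator-allowed : ∀ {i e} {J : Subset (2 + m)} → SquareGenerator i e → i ∈ J → Allowed J e
  square-generator-allowed is-ρ₀ i∈J = i∈J , tt
  square-generator-allowed is-ρ₁ i∈J = tt , i∈J

  square-involutive : ∀ {i e} → SquareGenerator i e → ∀ x → ρ T i ⟨$⟩ʳ (ρ T i ⟨$⟩ʳ x) ≡ x
  square-involutive {i} {e} g x = by (squareView x)
    where
    by : SquareView x → ρ T i ⟨$⟩ʳ (ρ T i ⟨$⟩ʳ x) ≡ x
    by (onSquare s refl) rewrite square-generator-corner g s | square-generator-corner g (s ⊕ e) =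
      cong corner (⊕-cancelʳ s e)
    by (offSquare off) rewrite square-generator-off g off = square-generator-off g off

  -- ρ₀, ρ₁ only move points inside the square, hence fix the tree point.
  square-generator-treePoint : ∀ {i e} → SquareGenerator i e → ∀ x → treePoint (ρ T i ⟨$⟩ʳ x) ≡ treePoint x
  square-generator-treePoint {i} {e} g x = by (squareView x)
    where
    by : SquareView x → treePoint (ρ T i ⟨$⟩ʳ x) ≡ treePoint x
    by (onSquare s refl) = begin
      treePoint (ρ T i ⟨$⟩ʳ corner s) ≡⟨ cong treePoint (square-generator-corner g s) ⟩
      treePoint (corner (s ⊕ e))      ≡⟨ treePoint-corner (s ⊕ e) ⟩
      t                               ≡⟨ treePoint-corner s ⟨
      treePoint (corner s)            ∎
      where open ≡-Reasoning
    by (offSquare off) = cong treePoint (square-generator-off g off)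

  square-generator-sqCoord : ∀ {i e J} → SquareGenerator i e → i ∈ J →
                             ∀ x → SquareOrbit J (sqCoord x) (sqCoord (ρ T i ⟨$⟩ʳ x))
  square-generator-sqCoord {i} {e} {J} g i∈J x = by (squareView x)
    where
    by : SquareView x → SquareOrbit J (sqCoord x) (sqCoord (ρ T i ⟨$⟩ʳ x))
    by (onSquare s refl)
      rewrite square-generator-corner g s | sqCoord-corner s | sqCoord-corner (s ⊕ e) =
      subst (Allowed J) (sym (⊕-cancelˡ s e)) (square-generator-allowed g i∈J)
    by (offSquare off) rewrite square-generator-off g off = square-orbit-refl (sqCoord x)

  involutive : ∀ i x → ρ T i ⟨$⟩ʳ (ρ T i ⟨$⟩ʳ x) ≡ x
  involutive zero          = square-involutive is-ρ₀
  involutive (suc zero)    = square-involutive is-ρ₁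
  involutive (suc (suc k)) = transpose-involutive (proj₁ (edge k)) (proj₂ (edge k))

  not-identity : ∀ i → ¬ (∀ x → ρ T i ⟨$⟩ʳ x ≡ x)
  not-identity zero          fixes = a₁≢a₂ (trans (sym (fixes a₁)) (square-generator-corner is-ρ₀ o))
  not-identity (suc zero)    fixes = a₁≢a₃ (trans (sym (fixes a₁)) (square-generator-corner is-ρ₁ o))
  not-identity (suc (suc k)) fixes =
    edge-loopless k (trans (sym (fixes (proj₁ (edge k)))) (transpose-matchˡ (proj₁ (edge k)) (proj₂ (edge k))))

  open Orbits (ρ T) involutive

  EdgeIn : Subset (2 + m) → Fin m → Set
  EdgeIn J k = suc (suc k) ∈ J

  generator-treePoint : ∀ {J} i → i ∈ J → ∀ x →
                        Reach edge (EdgeIn J) (treePoint x) (treePoint (ρ T i ⟨$⟩ʳ x))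
  generator-treePoint {J} zero       _ x =
    subst (Reach edge (EdgeIn J) (treePoint x)) (sym (square-generator-treePoint is-ρ₀ x)) here
  generator-treePoint {J} (suc zero) _ x =
    subst (Reach edge (EdgeIn J) (treePoint x)) (sym (square-generator-treePoint is-ρ₁ x)) here
  generator-treePoint {J} (suc (suc k)) k∈J x with edge-step k x
  ... | inj₁ j =
    subst₂ (Reach edge (EdgeIn J)) (sym (proj₂ (endpoint-coordinates j)))
           (sym (proj₂ (endpoint-coordinates (joins-sym j)))) (step k k∈J j here)
  ... | inj₂ fixed rewrite fixed = here

  generator-sqCoord : ∀ {J} i → i ∈ J → ∀ x → SquareOrbit J (sqCoord x) (sqCoord (ρ T i ⟨$⟩ʳ x))
  generator-sqCoord zero          i∈J = square-generator-sqCoord is-ρ₀ i∈J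
  generator-sqCoord (suc zero)    i∈J = square-generator-sqCoord is-ρ₁ i∈J
  generator-sqCoord {J} (suc (suc k)) _ x with edge-step k x
  ... | inj₁ j rewrite proj₁ (endpoint-coordinates j) | proj₁ (endpoint-coordinates (joins-sym j)) =
    square-orbit-refl {J = J} top
  ... | inj₂ fixed rewrite fixed = square-orbit-refl {J = J} (sqCoord x)

  orbit⇒tree : ∀ {J x y} → Orbit J x y → Reach edge (EdgeIn J) (treePoint x) (treePoint y)
  orbit⇒tree stay                     = here
  orbit⇒tree {x = x} (move i i∈J o)   = reach-trans (generator-treePoint i i∈J x) (orbit⇒tree o)

  orbit⇒square : ∀ {J x y} → Orbit J x y → SquareOrbit J (sqCoord x) (sqCoord y)
  orbit⇒square {x = x} stay                 = square-orbit-refl (sqCoord x)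
  orbit⇒square {x = x} {y} (move i i∈J o)   =
    square-orbit-trans (sqCoord x) (sqCoord (ρ T i ⟨$⟩ʳ x)) (sqCoord y) (generator-sqCoord i i∈J x) (orbit⇒square o)

  translation : Sq → Permutation′ (m + 4)
  translation (b₀ , b₁) = power b₀ (ρ T zero) ∘ₚ power b₁ (ρ T (suc zero))

  Translates : Permutation′ (m + 4) → Sq → Set
  Translates σ h = ∀ s → σ ⟨$⟩ʳ corner s ≡ corner (s ⊕ h)

  translation-translates : ∀ h → Translates (translation h) h
  translation-translates (false , false) s = cong corner (sym (⊕-identityʳ s))
  translation-translates (true  , false) s = square-generator-corner is-ρ₀ s
  translation-translates (false , true)  s = square-generator-corner is-ρ₁ s
  translation-translates (true  , true)  s = begin
    ρ T (suc zero) ⟨$⟩ʳ (ρ T zero ⟨$⟩ʳ corner s) ≡⟨ cong (ρ T (suc zero) ⟨$⟩ʳ_) (square-generator-corner is-ρ₀ s) ⟩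
    ρ T (suc zero) ⟨$⟩ʳ corner (s ⊕ e₀)         ≡⟨ square-generator-corner is-ρ₁ (s ⊕ e₀) ⟩
    corner (s ⊕ e₀ ⊕ e₁)                         ≡⟨ cong corner (⊕-assoc s e₀ e₁) ⟩
    corner (s ⊕ top)                             ∎
    where open ≡-Reasoning

  translation-gen : ∀ {J} h → Allowed J h → Gen (ρ T) J (translation h)
  translation-gen {J} (b₀ , b₁) (u₀ , u₁) = gen-mul (power-gen b₀ zero u₀) (power-gen b₁ (suc zero) u₁)
    where open Generation (ρ T) J

  square⇒orbit : ∀ {J s s′} → SquareOrbit J s s′ → Orbit J (corner s) (corner s′)
  square⇒orbit {J} {s} {s′} allowed =
    subst (Orbit J (corner s)) (trans (translation-translates (s ⊕ s′) s) (cong corner (⊕-cancelˡ s s′)))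
          (orbit-of-gen (translation-gen (s ⊕ s′) allowed) (corner s))

  tree⇒orbit : ∀ {J x y} → Reach edge (EdgeIn J) x y → Orbit J x y
  tree⇒orbit here                 = stay
  tree⇒orbit {J} (step k k∈J j r) =
    move (suc (suc k)) k∈J (subst (λ w → Orbit J w _) (sym (joins-moves j)) (tree⇒orbit r))

  orbit-from-coordinates : ∀ {J} x y → Reach edge (EdgeIn J) (treePoint x) (treePoint y) →
                           SquareOrbit J (sqCoord x) (sqCoord y) → Orbit J x y
  orbit-from-coordinates {J} x y tree sq = by (squareView x) (squareView y)
    where
    tree′ : ∀ {x′ y′} → treePoint x ≡ x′ → treePoint y ≡ y′ → Orbit J x′ y′
    tree′ ex ey = tree⇒orbit (subst₂ (Reach edge (EdgeIn J)) ex ey tree)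
    square′ : ∀ {s s′} → sqCoord x ≡ s → sqCoord y ≡ s′ → Orbit J (corner s) (corner s′)
    square′ {s} {s′} ex ey = square⇒orbit {J} {s} {s′} (subst₂ (SquareOrbit J) ex ey sq)
    by : SquareView x → SquareView y → Orbit J x y
    by (onSquare s refl) (onSquare s′ refl) = square′ (sqCoord-corner s) (sqCoord-corner s′)
    by (onSquare s refl) (offSquare off)    =
      orbit-trans (square′ (sqCoord-corner s) (sqCoord-off off)) (tree′ (treePoint-corner s) (treePoint-off off))
    by (offSquare off)   (onSquare s refl)  =
      orbit-trans (tree′ (treePoint-off off) (treePoint-corner s)) (square′ (sqCoord-off off) (sqCoord-corner s))
    by (offSquare off)   (offSquare off′)   = tree′ (treePoint-off off) (treePoint-off off′)

  -- The orbits of ⟨ρ_j : j ∈ J ∩ K⟩ are the intersections of the J- and K-orbits;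
  -- for the tree part this is the unique-path property of T.
  orbit-meet : ∀ {J K x y} → Orbit J x y → Orbit K x y → Orbit (J ∩ K) x y
  orbit-meet {J} {K} {x} {y} oJ oK = orbit-from-coordinates x y
    (reach-mono x∈p∩q⁺ (reach-meet acyclic (λ k → suc (suc k) ∈? K) (orbit⇒tree oJ) (orbit⇒tree oK)))
    (Allowed-∩ (sqCoord x ⊕ sqCoord y) (orbit⇒square oJ) (orbit⇒square oK))

  joins-gen : ∀ {J k x y} → Joins edge k x y → EdgeIn J k → Gen (ρ T) J (transpose x y)
  joins-gen {J} (inj₁ eq) k∈J = subst (λ e → Gen (ρ T) J (transpose (proj₁ e) (proj₂ e))) eq (gen-gen k∈J)
  joins-gen {J} (inj₂ eq) k∈J =
    transposition-flip (subst (λ e → Gen (ρ T) J (transpose (proj₁ e) (proj₂ e))) eq (gen-gen k∈J))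
    where open Generation (ρ T) J

  reach-gen : ∀ {J x y} → Reach edge (EdgeIn J) x y → Gen (ρ T) J (transpose x y)
  reach-gen {J} {x} here             = transposition-self x
    where open Generation (ρ T) J
  reach-gen {J} (step k k∈J j r)     = transposition-chain (joins-gen j k∈J) (reach-gen r)
    where open Generation (ρ T) J

  label₂ : Fin (2 + m)
  label₂ = suc (suc edge₂)

  neighbour : Σ Point (Joins edge edge₂ t)
  neighbour with t-on-2
  ... | inj₁ eq = proj₂ (edge edge₂) , inj₁ (cong (_, proj₂ (edge edge₂)) (sym eq))
  ... | inj₂ eq = proj₁ (edge edge₂) , inj₂ (cong (proj₁ (edge edge₂) ,_) (sym eq))

  u : Point
  u = proj₁ neighbour

  u-off : OffSquare u
  u-off = off-square (edge-notA₁ edge₂ u t u-t) (edge-notA₂ edge₂ u t u-t) (edge-notA₃ edge₂ u t u-t)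
                     (λ u≡t → joins-distinct u-t u≡t)
    where
    u-t : Joins edge edge₂ u t
    u-t = joins-sym (proj₂ neighbour)

  -- When ρ₂ is available, every generator step x ↦ ρᵢ x is a generated
  -- transposition, so ⟨ρ_j : j ∈ J⟩ is the Young subgroup of its orbits.
  module WithEdge₂ {J : Subset (2 + m)} (2∈J : label₂ ∈ J) where
    open Generation (ρ T) J

    t-u : Gen (ρ T) J (transpose t u)
    t-u = joins-gen (proj₂ neighbour) 2∈J

    -- (ρᵢ t  t): conjugate (t u) by ρᵢ, which fixes u, and chain with (u t).
    square-pair-t : ∀ {i e} → SquareGenerator i e → i ∈ J → Gen (ρ T) J (transpose (corner (top ⊕ e)) t)
    square-pair-t g i∈J = transposition-chain
      (subst₂ (λ a b → Gen (ρ T) J (transpose a b)) (square-generator-corner g top) (square-generator-off g u-off)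
              (transposition-conjugate (gen-gen i∈J) t-u))
      (transposition-flip t-u)

    square-pair-o : ∀ {i e} → SquareGenerator i e → i ∈ J → Gen (ρ T) J (transpose (corner o) (corner (o ⊕ e)))
    square-pair-o g i∈J =
      transposition-split (subst (Gen (ρ T) J) (square-generator-form g) (gen-gen i∈J)) (square-pair-t g i∈J)

    square-pair : ∀ {i e} → SquareGenerator i e → i ∈ J → ∀ s → Gen (ρ T) J (transpose (corner s) (corner (s ⊕ e)))
    square-pair is-ρ₀ i∈J (false , false) = square-pair-o is-ρ₀ i∈J
    square-pair is-ρ₀ i∈J (true  , false) = transposition-flip (square-pair-o is-ρ₀ i∈J)
    square-pair is-ρ₀ i∈J (false , true)  = square-pair-t is-ρ₀ i∈J
    square-pair is-ρ₀ i∈J (true  , true)  = transposition-flip (square-pair-t is-ρ₀ i∈J)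
    square-pair is-ρ₁ i∈J (false , false) = square-pair-o is-ρ₁ i∈J
    square-pair is-ρ₁ i∈J (false , true)  = transposition-flip (square-pair-o is-ρ₁ i∈J)
    square-pair is-ρ₁ i∈J (true  , false) = square-pair-t is-ρ₁ i∈J
    square-pair is-ρ₁ i∈J (true  , true)  = transposition-flip (square-pair-t is-ρ₁ i∈J)

    square-generator-step : ∀ {i e} → SquareGenerator i e → i ∈ J → ∀ x → Gen (ρ T) J (transpose x (ρ T i ⟨$⟩ʳ x))
    square-generator-step {i} g i∈J x = by (squareView x)
      where
      by : SquareView x → Gen (ρ T) J (transpose x (ρ T i ⟨$⟩ʳ x))
      by (onSquare s refl) =
        subst (λ w → Gen (ρ T) J (transpose (corner s) w)) (sym (square-generator-corner g s)) (square-pair g i∈J s)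
      by (offSquare off) =
        subst (λ w → Gen (ρ T) J (transpose x w)) (sym (square-generator-off g off)) (transposition-self x)

    generator-step : ∀ i → i ∈ J → ∀ x → Gen (ρ T) J (transpose x (ρ T i ⟨$⟩ʳ x))
    generator-step zero          = square-generator-step is-ρ₀
    generator-step (suc zero)    = square-generator-step is-ρ₁
    generator-step (suc (suc k)) k∈J x with edge-step k x
    ... | inj₁ j     = joins-gen j k∈J
    ... | inj₂ fixed rewrite fixed = transposition-self x

    generated-by-orbits : ∀ σ → (∀ x → Orbit J x (σ ⟨$⟩ʳ x)) → Gen (ρ T) J σ
    generated-by-orbits = orbit-young generator-step

  -- An edge other than the one labelled 2 misses the square, since t is a leaf.
  edge-fixes-square : ∀ k → k ≢ edge₂ → ∀ s → ρ T (suc (suc k)) ⟨$⟩ʳ corner s ≡ corner s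
  edge-fixes-square k k≢edge₂ s with edge-step k (corner s)
  ... | inj₂ fixed = fixed
  ... | inj₁ j     = ⊥-elim (k≢edge₂ (t-leaf k _ (subst (λ w → Joins edge k w (ρ T (suc (suc k)) ⟨$⟩ʳ corner s)) corner-s≡t j)))
    where
    corner-s≡t : corner s ≡ t
    corner-s≡t = cong corner (trans (sym (sqCoord-corner s)) (proj₁ (endpoint-coordinates j)))

  gen-translates : ∀ {J σ} → label₂ ∉ J → Gen (ρ T) J σ → Σ Sq (Translates σ)
  gen-translates 2∉J gen-id                       = o , λ s → cong corner (sym (⊕-identityʳ s))
  gen-translates 2∉J (gen-gen {zero} _)           = e₀ , square-generator-corner is-ρ₀
  gen-translates 2∉J (gen-gen {suc zero} _)       = e₁ , square-generator-corner is-ρ₁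
  gen-translates {J} 2∉J (gen-gen {suc (suc k)} k∈J) =
    o , λ s → trans (edge-fixes-square k k≢edge₂ s) (cong corner (sym (⊕-identityʳ s)))
    where
    k≢edge₂ : k ≢ edge₂
    k≢edge₂ k≡edge₂ = 2∉J (subst (EdgeIn J) k≡edge₂ k∈J)
  gen-translates 2∉J (gen-mul {σ} {τ} gσ gτ) with gen-translates 2∉J gσ | gen-translates 2∉J gτ
  ... | h , σh | k , τk = h ⊕ k , λ s → begin
    τ ⟨$⟩ʳ (σ ⟨$⟩ʳ corner s) ≡⟨ cong (τ ⟨$⟩ʳ_) (σh s) ⟩
    τ ⟨$⟩ʳ corner (s ⊕ h)    ≡⟨ τk (s ⊕ h) ⟩
    corner (s ⊕ h ⊕ k)       ≡⟨ cong corner (⊕-assoc s h k) ⟩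
    corner (s ⊕ (h ⊕ k))     ∎
    where open ≡-Reasoning
  gen-translates 2∉J (gen-inv {σ} gσ) with gen-translates 2∉J gσ
  ... | h , σh = h , λ s → begin
    σ ⟨$⟩ˡ corner s                        ≡⟨ cong (λ w → σ ⟨$⟩ˡ corner w) (⊕-cancelʳ s h) ⟨
    σ ⟨$⟩ˡ corner (s ⊕ h ⊕ h)              ≡⟨ cong (σ ⟨$⟩ˡ_) (σh (s ⊕ h)) ⟨
    σ ⟨$⟩ˡ (σ ⟨$⟩ʳ corner (s ⊕ h))         ≡⟨ inverseˡ σ ⟩
    corner (s ⊕ h)                         ∎
    where open ≡-Reasoning
  gen-translates 2∉J (gen-ext eq gσ) with gen-translates 2∉J gσ
  ... | h , σh = h , λ s → trans (sym (eq (corner s))) (σh s)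

  translation-allowed : ∀ {J σ h} → (∀ x → Orbit J x (σ ⟨$⟩ʳ x)) → Translates σ h → Allowed J h
  translation-allowed {J} {σ} {h} orbits σh =
    subst (Allowed J) (⊕-cancelˡ o h)
          (subst₂ (SquareOrbit J) (sqCoord-corner o) (trans (cong sqCoord (σh o)) (sqCoord-corner (o ⊕ h)))
                  (orbit⇒square (orbits (corner o))))

  -- An orbit-preserving σ that translates the square is generated: undo the
  -- translation inside ⟨ρ₀, ρ₁⟩; what remains fixes the square and moves
  -- the other points along available edges of T.
  generated-by-translation : ∀ {J σ h} → (∀ x → Orbit J x (σ ⟨$⟩ʳ x)) → Translates σ h → Gen (ρ T) J σ
  generated-by-translation {J} {σ} {h} orbits σh =
    gen-ext (λ x → inverseʳ w) (gen-mul (Young.young (Reach edge (EdgeIn J)) reach-sym reach-trans reach-gen σ′ along-T) gw)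
    where
    open Generation (ρ T) J
    w : Permutation′ (m + 4)
    w = translation h
    gw : Gen (ρ T) J w
    gw = translation-gen {J} h (translation-allowed {J} {σ} orbits σh)
    σ′ : Permutation′ (m + 4)
    σ′ = σ ∘ₚ flip w
    σ′-fixes-square : ∀ s → σ′ ⟨$⟩ʳ corner s ≡ corner s
    σ′-fixes-square s = trans (cong (w ⟨$⟩ˡ_) (trans (σh s) (sym (translation-translates h s)))) (inverseˡ w)
    along-T : ∀ x → Reach edge (EdgeIn J) x (σ′ ⟨$⟩ʳ x)
    along-T x = by (squareView x)
      where
      by : SquareView x → Reach edge (EdgeIn J) x (σ′ ⟨$⟩ʳ x)
      by (onSquare s refl) = subst (Reach edge (EdgeIn J) (corner s)) (sym (σ′-fixes-square s)) here
      by (offSquare off)   = subst₂ (Reach edge (EdgeIn J)) (treePoint-off off) (treePoint-off off′)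
                                    (orbit⇒tree (orbit-trans (orbits x) (orbit-of-gen (gen-inv gw) (σ ⟨$⟩ʳ x))))
        where
        off′ : OffSquare (σ′ ⟨$⟩ʳ x)
        off′ s eq = off s (⟨$⟩ʳ-injective σ′ (trans eq (sym (σ′-fixes-square s))))

  generated : ∀ {J σ} → (∀ x → Orbit J x (σ ⟨$⟩ʳ x)) → (label₂ ∉ J → Σ Sq (Translates σ)) → Gen (ρ T) J σ
  generated {J} {σ} orbits translates with label₂ ∈? J
  ... | yes 2∈J = WithEdge₂.generated-by-orbits 2∈J σ orbits
  ... | no 2∉J  = generated-by-translation orbits (proj₂ (translates 2∉J))

  intersection : ∀ {J K σ} → Gen (ρ T) J σ → Gen (ρ T) K σ → Gen (ρ T) (J ∩ K) σ
  intersection {J} {K} {σ} gJ gK =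
    generated (λ x → orbit-meet (orbit-of-gen gJ x) (orbit-of-gen gK x)) translates
    where
    translates : label₂ ∉ J ∩ K → Σ Sq (Translates σ)
    translates 2∉J∩K with label₂ ∈? J
    ... | no 2∉J  = gen-translates 2∉J gJ
    ... | yes 2∈J = gen-translates (λ 2∈K → 2∉J∩K (x∈p∩q⁺ (2∈J , 2∈K))) gK

  -- All points lie in one orbit: the square via ρ₀, ρ₁ and T via connectivity.
  orbit-to-t : ∀ x → Orbit ⊤ x t
  orbit-to-t x = by (squareView x)
    where
    by : SquareView x → Orbit ⊤ x t
    by (onSquare s refl) = square⇒orbit {s = s} {top} (Allowed-⊤ (s ⊕ top))
    by (offSquare off)   = tree⇒orbit (reach-mono (λ _ → ∈⊤)
      (connected x t (off o) (off e₀) (off e₁) (≢-sym a₁≢t) (≢-sym a₂≢t) (≢-sym a₃≢t)))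

  generates-Sym : GeneratesSym (ρ T)
  generates-Sym σ = generated (λ x → orbit-trans (orbit-to-t x) (orbit-sym (orbit-to-t (σ ⟨$⟩ʳ x))))
                              (λ 2∉⊤ → ⊥-elim (2∉⊤ ∈⊤))

  is-C-group : IsCGroup (ρ T)
  is-C-group = (λ i → involutive i , not-identity i)
             , λ J K σ → (λ (gJ , gK) → intersection gJ gK)
                       , (λ g → gen-mono (p∩q⊆p J K) g , gen-mono (p∩q⊆q J K) g)

lemma6p4 : ∀ m → 5 ≤ m → (T : TypeC m) → GeneratesSym (ρ T) × IsCGroup (ρ T)
lemma6p4 m _ T = generates-Sym , is-C-group
  where open TypeCGroup T
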